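{- For the binary alphabet $\{0,1\}$, any algorithm that recovers an arbitrary input sequence $s\in\{0,1\}^{\ell}$, $0\le\ell\le n$, by querying the Levenshtein distance from $s$ to a set of query sequences of length $\mathcal{O}(n)$, has query complexity $\Omega(n/\log n)$.
   Context: The Levenshtein (edit) distance $d_L(x,y)$ is the minimal number of single-symbol insertions, deletions and substitutions transforming $x$ into $y$. Query model: $s$ is unknown (its length too); the algorithm chooses query sequences $q$ and receives $d_L(s,q)$; query complexity is the number of queries. -}

module Defs where

open import Data.Bool using (Bool; true; false; if_then_else_)
open import Data.Bool.Properties using () renaming (_≟_ to _≟B_)
open import Data.Nat using (ℕ; zero; suc; _⊓_)
open import Data.List using (List; []; _∷_; length; _++_)
open import Relation.Nullary using (yes; no)

-- Binary sequences over the alphabet {0,1} (false = 0, true = 1).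
Seq : Set
Seq = List Bool

lev : Seq → Seq → ℕ
lev [] ys = length ys
lev (x ∷ xs) [] = suc (length xs)
lev (x ∷ xs) (y ∷ ys) =
  (sub (x ≟B y)) ⊓ (suc (lev xs (y ∷ ys)) ⊓ suc (lev (x ∷ xs) ys))
  where
  sub : _ → ℕ
  sub (yes _) = lev xs ys
  sub (no _)  = suc (lev xs ys)

-- An adaptive query algorithm: a (well-founded) decision tree.
data Alg : Set where
  done : Seq → Alg
  ask  : Seq → (ℕ → Alg) → Alg

output : Alg → Seq → Seq
output (done x) s = x
output (ask q k) s = output (k (lev s q)) s

queries : Alg → Seq → List Seq
queries (done x) s = []
queries (ask q k) s = q ∷ queries (k (lev s q)) s

{-# OPTIONS --safe #-}
module Submission where

-- An algorithm that, on every input of length n, asks at most k queries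
-- is a decision tree of depth k.  Since d_L(s,q) ≤ |s| + |q|, each answer
-- lies in {0, …, n + Cn}, so the tree has at most (n + Cn + 1)^k leaves and
-- can recover at most that many inputs.  Recovering all 2^n inputs of
-- length n forces 2^n ≤ (n + Cn + 1)^k ≤ 2^(2 k log₂ n) once n ≥ 2^(C+2),
-- where k is the number of queries spent on a worst-case input.

open import Defs
open import Data.Bool using (true; false)
open import Data.Empty using (⊥)
open import Data.List using (List; []; _∷_; _++_; length; map; filter; replicate)
open import Data.List.Extrema.Nat using (argmax; f[xs]≤f[argmax]; argmax-all)
open import Data.List.Membership.Propositional using (_∈_)
open import Data.List.Membership.Propositional.Properties using (∈-map⁻)
open import Data.List.Properties using (length-++; length-map; length-replicate; ∷-injectiveʳ)
open import Data.List.Relation.Unary.All using (All; []; _∷_)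
import Data.List.Relation.Unary.All as All
import Data.List.Relation.Unary.All.Properties as All
open import Data.List.Relation.Unary.AllPairs using ([]; _∷_)
open import Data.List.Relation.Unary.Unique.Propositional using (Unique)
import Data.List.Relation.Unary.Unique.Propositional.Properties as Unique
open import Data.Nat using (ℕ; suc; zero; _+_; _*_; _^_; _≤_; _<_; _≟_; z≤n; s≤s; s≤s⁻¹; z<s)
open import Data.Nat.Logarithm using (⌊log₂_⌋; ⌊log₂⌋-mono-≤; ⌊log₂[2^n]⌋≡n)
open import Data.Nat.Properties
open import Data.Product using (Σ; _×_; _,_)
open import Relation.Nullary using (¬_; yes; no)
open import Relation.Unary using (Pred; Decidable)
open import Relation.Unary.Properties using (∁?)
open import Relation.Binary.PropositionalEquality
  using (_≡_; refl; sym; trans; cong; cong₂; subst; module ≡-Reasoning)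

lev≤length+length : ∀ s q → lev s q ≤ length s + length q
lev≤length+length []       q        = ≤-refl
lev≤length+length (x ∷ xs) []       = s≤s (≤-reflexive (sym (+-identityʳ _)))
lev≤length+length (x ∷ xs) (y ∷ ys) =
  ≤-trans (m⊓n≤n _ _) (≤-trans (m⊓n≤m _ _) (s≤s (lev≤length+length xs (y ∷ ys))))

module _ {a} {A : Set a} where

  length-filter+reject : ∀ {p} {P : Pred A p} (P? : Decidable P) xs →
                         length xs ≡ length (filter P? xs) + length (filter (∁? P?) xs)
  length-filter+reject P? []       = refl
  length-filter+reject P? (x ∷ xs) with P? x
  ... | yes _ = cong suc (length-filter+reject P? xs)
  ... | no  _ = trans (cong suc (length-filter+reject P? xs)) (sym (+-suc _ _))

  Unique-constant⇒length≤1 : ∀ {x : A} {xs} → Unique xs → All (x ≡_) xs → length xs ≤ 1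
  Unique-constant⇒length≤1 {xs = []}        _               _                 = z≤n
  Unique-constant⇒length≤1 {xs = _ ∷ []}    _               _                 = s≤s z≤n
  Unique-constant⇒length≤1 {xs = _ ∷ _ ∷ _} ((y≢z ∷ _) ∷ _) (refl ∷ refl ∷ _) with () ← y≢z refl

  module _ {p} (g : A → ℕ) (P : Pred A p) (B : ℕ)
           (class-bound : ∀ v {xs} → Unique xs → All (λ x → g x ≡ v × P x) xs → length xs ≤ B)
           where

    length≤classes*bound : ∀ m {xs} → Unique xs → All (λ x → g x < m × P x) xs → length xs ≤ m * B
    length≤classes*bound zero    {[]}    _ _              = z≤n
    length≤classes*bound zero    {_ ∷ _} _ ((() , _) ∷ _)
    length≤classes*bound (suc m) {xs}    u all = begin
      length xs
        ≡⟨ length-filter+reject g≟m xs ⟩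
      length (filter g≟m xs) + length (filter (∁? g≟m) xs)
        ≤⟨ +-mono-≤ (class-bound m (Unique.filter⁺ g≟m u) in-class)
                    (length≤classes*bound m (Unique.filter⁺ (∁? g≟m) u) below-m) ⟩
      B + m * B
        ∎
      where
      open ≤-Reasoning
      g≟m : Decidable (λ x → g x ≡ m)
      g≟m x = g x ≟ m
      in-class : All (λ x → g x ≡ m × P x) (filter g≟m xs)
      in-class = All.zipWith (λ (eq , _ , px) → eq , px)
                   (All.all-filter g≟m xs , All.filter⁺ g≟m all)
      below-m : All (λ x → g x < m × P x) (filter (∁? g≟m) xs)
      below-m = All.zipWith (λ (neq , lt , px) → ≤∧≢⇒< (s≤s⁻¹ lt) neq , px)
                  (All.all-filter (∁? g≟m) xs , All.filter⁺ (∁? g≟m) all)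

module _ (M : ℕ) where

  RecoversWithin : Alg → ℕ → Seq → Set
  RecoversWithin (done x)  k       s = x ≡ s
  RecoversWithin (ask q f) zero    s = ⊥
  RecoversWithin (ask q f) (suc k) s = lev s q ≤ M × RecoversWithin (f (lev s q)) k s

  RecoversWithin-mono : ∀ A {k k′} s → k ≤ k′ → RecoversWithin A k s → RecoversWithin A k′ s
  RecoversWithin-mono (done x)  s _          r         = r
  RecoversWithin-mono (ask q f) s (s≤s k≤k′) (a≤M , r) =
    a≤M , RecoversWithin-mono (f (lev s q)) s k≤k′ r

  correct⇒RecoversWithin : ∀ A s → output A s ≡ s → All (λ q → lev s q ≤ M) (queries A s) →
                           RecoversWithin A (length (queries A s)) s
  correct⇒RecoversWithin (done x)  s out _            = out
  correct⇒RecoversWithin (ask q f) s out (a≤M ∷ a≤Ms) =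
    a≤M , correct⇒RecoversWithin (f (lev s q)) s out a≤Ms

  Unique-RecoversWithin⇒length≤ : ∀ A k {S} → Unique S → All (RecoversWithin A k) S →
                                  length S ≤ suc M ^ k
  Unique-RecoversWithin⇒length≤ (done x)  k       u r =
    ≤-trans (Unique-constant⇒length≤1 u r) (m^n>0 (suc M) k)
  Unique-RecoversWithin⇒length≤ (ask q f) zero    {[]}    _ _        = z≤n
  Unique-RecoversWithin⇒length≤ (ask q f) zero    {_ ∷ _} _ (() ∷ _)
  Unique-RecoversWithin⇒length≤ (ask q f) (suc k) u r =
    length≤classes*bound (λ s → lev s q) (λ s → RecoversWithin (f (lev s q)) k s) (suc M ^ k)
      (λ v u′ r′ → Unique-RecoversWithin⇒length≤ (f v) k u′ (All.map (λ { (refl , rs) → rs }) r′))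
      (suc M) u (All.map (λ (a≤M , rs) → s≤s a≤M , rs) r)

seqsOfLength : ℕ → List Seq
seqsOfLength zero    = [] ∷ []
seqsOfLength (suc n) = map (true ∷_) (seqsOfLength n) ++ map (false ∷_) (seqsOfLength n)

seqsOfLength-sized : ∀ n → All (λ s → length s ≡ n) (seqsOfLength n)
seqsOfLength-sized zero    = refl ∷ []
seqsOfLength-sized (suc n) = All.++⁺ (All.map⁺ sized) (All.map⁺ sized)
  where
  sized : All (λ s → suc (length s) ≡ suc n) (seqsOfLength n)
  sized = All.map (cong suc) (seqsOfLength-sized n)

length-seqsOfLength : ∀ n → length (seqsOfLength n) ≡ 2 ^ n
length-seqsOfLength zero    = refl
length-seqsOfLength (suc n) = begin
  length (map (true ∷_) S ++ map (false ∷_) S)         ≡⟨ length-++ (map (true ∷_) S) ⟩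
  length (map (true ∷_) S) + length (map (false ∷_) S) ≡⟨ cong₂ _+_ (length-map _ S) (length-map _ S) ⟩
  length S + length S                                  ≡⟨ cong₂ _+_ (length-seqsOfLength n)
                                                                    (length-seqsOfLength n) ⟩
  2 ^ n + 2 ^ n                                        ≡⟨ cong (2 ^ n +_) (sym (+-identityʳ _)) ⟩
  2 ^ suc n                                            ∎
  where
  open ≡-Reasoning
  S : List Seq
  S = seqsOfLength n

seqsOfLength-unique : ∀ n → Unique (seqsOfLength n)
seqsOfLength-unique zero    = [] ∷ []
seqsOfLength-unique (suc n) =
  Unique.++⁺ (Unique.map⁺ ∷-injectiveʳ (seqsOfLength-unique n))
             (Unique.map⁺ ∷-injectiveʳ (seqsOfLength-unique n))
             disjoint
  where
  disjoint : ∀ {s} → ¬ (s ∈ map (true ∷_) (seqsOfLength n) × s ∈ map (false ∷_) (seqsOfLength n))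
  disjoint (s∈₁ , s∈₂) with ∈-map⁻ (true ∷_) s∈₁ | ∈-map⁻ (false ∷_) s∈₂
  ... | _ , _ , refl | _ , _ , ()

worstCase-count : ∀ M n A → (∀ s → length s ≡ n → RecoversWithin M A (length (queries A s)) s) →
                  Σ Seq λ s → length s ≡ n × 2 ^ n ≤ suc M ^ length (queries A s)
worstCase-count M n A recovers = s* , |s*|≡n , counted
  where
  cost : Seq → ℕ
  cost s = length (queries A s)
  S : List Seq
  S = seqsOfLength n
  s* : Seq
  s* = argmax cost (replicate n false) S
  |s*|≡n : length s* ≡ n
  |s*|≡n = argmax-all cost (length-replicate n) (seqsOfLength-sized n)
  within : ∀ {s} → length s ≡ n × cost s ≤ cost s* → RecoversWithin M A (cost s*) s
  within {s} (|s|≡n , s≤s*) = RecoversWithin-mono M A s s≤s* (recovers s |s|≡n)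
  counted : 2 ^ n ≤ suc M ^ cost s*
  counted = subst (_≤ suc M ^ cost s*) (length-seqsOfLength n)
              (Unique-RecoversWithin⇒length≤ M A (cost s*) (seqsOfLength-unique n)
                 (All.zipWith within (seqsOfLength-sized n , f[xs]≤f[argmax] (replicate n false) S)))

n<2^n : ∀ n → n < 2 ^ n
n<2^n zero    = z<s
n<2^n (suc n) = begin-strict
  suc n          ≤⟨ n<2^n n ⟩
  2 ^ n          <⟨ m<m+n (2 ^ n) (m^n>0 2 n) ⟩
  2 ^ n + 2 ^ n  ≡⟨ cong (2 ^ n +_) (sym (+-identityʳ _)) ⟩
  2 ^ suc n      ∎
  where open ≤-Reasoning

n≤2^suc⌊log₂n⌋ : ∀ n → n ≤ 2 ^ suc ⌊log₂ n ⌋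
n≤2^suc⌊log₂n⌋ n = ≮⇒≥ λ 2^[1+L]<n →
  1+n≰n (subst (_≤ ⌊log₂ n ⌋) (⌊log₂[2^n]⌋≡n (suc ⌊log₂ n ⌋)) (⌊log₂⌋-mono-≤ (<⇒≤ 2^[1+L]<n)))

^-cancelˡ-≤ : ∀ m {n o} → 1 < m → m ^ n ≤ m ^ o → n ≤ o
^-cancelˡ-≤ m 1<m m^n≤m^o = ≮⇒≥ λ o<n → <⇒≱ (^-monoʳ-< m 1<m o<n) m^n≤m^o

exponent-bound : ∀ C n k → 2 ^ (2 + C) ≤ n → 2 ^ n ≤ suc (n + C * n) ^ k → n ≤ 2 * (k * ⌊log₂ n ⌋)
exponent-bound C n k 2^[2+C]≤n 2^n≤answers^k = ^-cancelˡ-≤ 2 (s≤s (s≤s z≤n)) (begin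
  2 ^ n                     ≤⟨ 2^n≤answers^k ⟩
  suc (n + C * n) ^ k       ≤⟨ ^-monoˡ-≤ k answers≤2^[2L] ⟩
  (2 ^ (2 * L)) ^ k         ≡⟨ ^-*-assoc 2 (2 * L) k ⟩
  2 ^ (2 * L * k)           ≡⟨ cong (2 ^_) (trans (*-assoc 2 L k) (cong (2 *_) (*-comm L k))) ⟩
  2 ^ (2 * (k * L))         ∎)
  where
  open ≤-Reasoning
  L : ℕ
  L = ⌊log₂ n ⌋
  2+C≤L : 2 + C ≤ L
  2+C≤L = subst (_≤ L) (⌊log₂[2^n]⌋≡n (2 + C)) (⌊log₂⌋-mono-≤ 2^[2+C]≤n)
  answers≤2^[2L] : suc (n + C * n) ≤ 2 ^ (2 * L)
  answers≤2^[2L] = begin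
    suc (n + C * n)           ≤⟨ +-monoˡ-≤ (n + C * n) (≤-trans (m^n>0 2 (2 + C)) 2^[2+C]≤n) ⟩
    (2 + C) * n               ≤⟨ *-mono-≤ (n<2^n (suc C)) (n≤2^suc⌊log₂n⌋ n) ⟩
    2 ^ suc C * 2 ^ suc L     ≡⟨ sym (^-distribˡ-+-* 2 (suc C) (suc L)) ⟩
    2 ^ (suc C + suc L)       ≤⟨ ^-monoʳ-≤ 2 (begin
      suc C + suc L             ≡⟨ cong suc (+-suc C L) ⟩
      2 + C + L                 ≤⟨ +-monoˡ-≤ L 2+C≤L ⟩
      L + L                     ≡⟨ cong (L +_) (sym (+-identityʳ L)) ⟩
      2 * L                     ∎) ⟩
    2 ^ (2 * L)               ∎

mainTheorem5 :
    (C : ℕ) →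
    Σ ℕ λ d → Σ ℕ λ N →
      (n : ℕ) → N ≤ n →
      (A : Alg) →
      ((s : Seq) → length s ≤ n →
         (output A s ≡ s) × All (λ q → length q ≤ C * n) (queries A s)) →
      Σ Seq λ s → (length s ≤ n) × (n ≤ d * (length (queries A s) * ⌊log₂ n ⌋))
mainTheorem5 C = 2 , 2 ^ (2 + C) , λ n 2^[2+C]≤n A correct →
  let recovers : ∀ s → length s ≡ n → RecoversWithin (n + C * n) A (length (queries A s)) s
      recovers s |s|≡n =
        let (out , short) = correct s (≤-reflexive |s|≡n)
            answer≤ : ∀ {q} → length q ≤ C * n → lev s q ≤ n + C * n
            answer≤ {q} |q|≤Cn = ≤-trans (lev≤length+length s q) (+-mono-≤ (≤-reflexive |s|≡n) |q|≤Cn)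
        in correct⇒RecoversWithin (n + C * n) A s out (All.map answer≤ short)
      (s , |s|≡n , counted) = worstCase-count (n + C * n) n A recovers
  in s , ≤-reflexive |s|≡n , exponent-bound C n (length (queries A s)) 2^[2+C]≤n counted
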